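{- Let $n$ be a positive integer and let $G$ be a bipartite graph having two vertices $x$ and $y$ in the same partite set such that $N(x)$ is a proper subset of $N(y)$. Then $\chi_{ld}(G[\overline{K_n}])\ge 3$.
   Context: Standing assumption: all graphs considered admit a local distance antimagic labeling and have no isolated vertices. For a graph $G=(V,E)$ of order $N$ and a bijection $f\colon V\to\{1,\dots,N\}$, the weight of a vertex $u$ is $w(u)=\sum_{x\in N(u)}f(x)$, where $N(u)$ is the open neighborhood of $u$. The bijection $f$ is a local distance antimagic labeling if $w(u)\neq w(v)$ for every edge $uv$. $\chi_{ld}(G)$ is the minimum number of distinct weights over all local distance antimagic labelings of $G$. $\overline{K_n}$ is the edgeless graph on $n$ vertices. The lexicographic product $G[H]$ has vertex set $V(G)\times V(H)$, with $(g,h)$ adjacent to $(g',h')$ iff $gg'\in E(G)$, or $g=g'$ and $hh'\in E(H)$. -}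

module Defs where

open import Data.Nat using (ℕ; zero; suc; _+_; _*_; _≤_)
open import Data.Nat.Properties using (_≟_)
open import Data.Fin using (Fin; toℕ; remQuot)
open import Data.Fin.Permutation using (Permutation′; _⟨$⟩ʳ_)
open import Data.Bool using (Bool; true; false; if_then_else_; _∨_; _∧_)
open import Data.List using (List; map; length; allFin; deduplicate)
open import Data.Nat.ListAction using (sum)
open import Data.Product using (Σ; ∃; _×_; _,_; proj₁; proj₂)
open import Relation.Binary.PropositionalEquality using (_≡_; _≢_)
open import Relation.Nullary using (¬_)

record Graph (N : ℕ) : Set where
  field
    adj    : Fin N → Fin N → Bool
    sym    : ∀ u v → adj u v ≡ adj v u
    irrefl : ∀ u → adj u u ≡ false
open Graph public

Adj : ∀ {N} → Graph N → Fin N → Fin N → Set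
Adj G u v = adj G u v ≡ true

edgeless : (n : ℕ) → Graph n
edgeless n = record { adj = λ _ _ → false ; sym = λ _ _ → _≡_.refl ; irrefl = λ _ → _≡_.refl }

-- Lexicographic product G[H]; vertex (g,h) is encoded in Fin (N * M) via remQuot.
-- (g,h) ~ (g',h')  iff  g g' ∈ E(G)  or  (g = g' and h h' ∈ E(H)).
private
  eqFin : ∀ {N} → Fin N → Fin N → Bool
  eqFin i j with toℕ i ≟ toℕ j
  ... | Relation.Nullary.yes _ = true
  ... | Relation.Nullary.no _  = false

open import Data.Fin.Properties using (toℕ-injective)
open import Relation.Binary.PropositionalEquality using (refl; cong; trans)
import Relation.Nullary as RN
open import Data.Bool.Properties using (∨-comm)

private
  eqFin-sym : ∀ {N} (i j : Fin N) → eqFin i j ≡ eqFin j i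
  eqFin-sym i j with toℕ i ≟ toℕ j | toℕ j ≟ toℕ i
  ... | RN.yes _ | RN.yes _ = refl
  ... | RN.no _  | RN.no _  = refl
  ... | RN.yes p | RN.no q  = Data.Empty.⊥-elim (q (Relation.Binary.PropositionalEquality.sym p))
    where import Data.Empty
  ... | RN.no p  | RN.yes q = Data.Empty.⊥-elim (p (Relation.Binary.PropositionalEquality.sym q))
    where import Data.Empty

pairAdj : ∀ {N M} → Graph N → Graph M → Fin N × Fin M → Fin N × Fin M → Bool
pairAdj G H (g , h) (g' , h') = adj G g g' ∨ (eqFin g g' ∧ adj H h h')

pairSym : ∀ {N M} (G : Graph N) (H : Graph M) p q → pairAdj G H p q ≡ pairAdj G H q p
pairSym G H (g , h) (g' , h')
  rewrite Graph.sym G g g' | eqFin-sym g g' | Graph.sym H h h' = refl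

pairIrr : ∀ {N M} (G : Graph N) (H : Graph M) p → pairAdj G H p p ≡ false
pairIrr G H (g , h) rewrite Graph.irrefl G g | Graph.irrefl H h with eqFin g g
... | true = refl
... | false = refl

lexAdj : ∀ {N M} → Graph N → Graph M → Fin (N * M) → Fin (N * M) → Bool
lexAdj {N} {M} G H u v = pairAdj G H (remQuot {N} M u) (remQuot {N} M v)

lex : ∀ {N M} → Graph N → Graph M → Graph (N * M)
lex {N} {M} G H = record { adj = lexAdj G H ; sym = λ u v → pairSym G H (remQuot {N} M u) (remQuot {N} M v) ; irrefl = λ u → pairIrr G H (remQuot {N} M u) }

-- Bipartite: there is a proper 2-colouring; the two colour classes are the partite sets.
Bipartition : ∀ {N} → Graph N → (Fin N → Bool) → Set
Bipartition G c = ∀ u v → Adj G u v → c u ≢ c v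

ProperNbhdSubset : ∀ {N} → Graph N → Fin N → Fin N → Set
ProperNbhdSubset G x y = (∀ v → Adj G x v → Adj G y v) × ∃ λ v → Adj G y v × ¬ Adj G x v

NoIsolated : ∀ {N} → Graph N → Set
NoIsolated G = ∀ u → ∃ λ v → Adj G u v

-- A labeling is a bijection f : V → {1,…,N}, represented by a permutation π of Fin N
-- with f(u) = toℕ (π u) + 1.
Labeling : ℕ → Set
Labeling N = Permutation′ N

label : ∀ {N} → Labeling N → Fin N → ℕ
label π u = suc (toℕ (π ⟨$⟩ʳ u))

weight : ∀ {N} → Graph N → Labeling N → Fin N → ℕ
weight G π u = sum (map (λ x → if adj G u x then label π x else 0) (allFin _))

IsLDAL : ∀ {N} → Graph N → Labeling N → Set
IsLDAL G π = ∀ u v → Adj G u v → weight G π u ≢ weight G π v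

numWeights : ∀ {N} → Graph N → Labeling N → ℕ
numWeights G π = length (deduplicate _≟_ (map (weight G π) (allFin _)))

-- χ_ld(G) ≥ k : every local distance antimagic labeling induces at least k distinct weights
-- (together with the standing assumption that some such labeling exists, this is
--  exactly "the minimum number of distinct weights is ≥ k").
χld≥ : ∀ {N} → Graph N → ℕ → Set
χld≥ G k = ∀ π → IsLDAL G π → k ≤ numWeights G π

module Submission where

open import Defs hiding (sym)
open import Data.Nat using (ℕ; suc; _*_; _≤_; _<_; z≤n; s≤s)
open import Data.Nat.Properties using (_≟_; ≤-refl; +-mono-≤; +-mono-<-≤; +-mono-≤-<; m≤n⇒m≤1+n; <⇒≢)
open import Data.Fin using (Fin; zero; combine; remQuot)
open import Data.Fin.Properties using (remQuot-combine)
open import Data.Bool using (Bool; true; false; if_then_else_)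
open import Data.Bool.Properties using (∧-zeroʳ)
open import Data.Product using (∃; _×_; _,_; proj₁; proj₂)
open import Data.List using (List; []; _∷_; map; length; allFin; deduplicate)
open import Data.List.Relation.Unary.Any using (here; there)
open import Data.List.Membership.Propositional using (_∈_)
open import Data.List.Membership.Propositional.Properties using (∈-map⁺; ∈-allFin; ∈-deduplicate⁺)
open import Data.Nat.ListAction using (sum)
open import Data.Empty using (⊥-elim)
open import Relation.Nullary using (¬_)
open import Relation.Binary.PropositionalEquality using (_≡_; _≢_; refl; sym; trans; cong)

-- Let v be a neighbour of x; it is also a neighbour of y. In G[K̄ n] the
-- copies (x,0), (y,0), (v,0) have neighbourhoods inherited from G, so N((x,0)) is a
-- proper subset of N((y,0)) and w(x,0) < w(y,0), while (v,0) is adjacent to both.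
-- Hence the three weights are pairwise distinct.

module _ {A : Set} where

  1≤length : ∀ {a : A} {xs} → a ∈ xs → 1 ≤ length xs
  1≤length (here _)  = s≤s z≤n
  1≤length (there _) = s≤s z≤n

  2≤length : ∀ {a b : A} {xs} → a ≢ b → a ∈ xs → b ∈ xs → 2 ≤ length xs
  2≤length a≢b (here refl) (here refl) = ⊥-elim (a≢b refl)
  2≤length a≢b (here refl) (there b∈) = s≤s (1≤length b∈)
  2≤length a≢b (there a∈)  (here _)   = s≤s (1≤length a∈)
  2≤length a≢b (there a∈)  (there b∈) = m≤n⇒m≤1+n (2≤length a≢b a∈ b∈)

  3≤length : ∀ {a b c : A} {xs} → a ≢ b → a ≢ c → b ≢ c
           → a ∈ xs → b ∈ xs → c ∈ xs → 3 ≤ length xs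
  3≤length a≢b a≢c b≢c (here refl) (here refl) _           = ⊥-elim (a≢b refl)
  3≤length a≢b a≢c b≢c (here refl) _           (here refl) = ⊥-elim (a≢c refl)
  3≤length a≢b a≢c b≢c _           (here refl) (here refl) = ⊥-elim (b≢c refl)
  3≤length a≢b a≢c b≢c (here refl) (there b∈)  (there c∈)  = s≤s (2≤length b≢c b∈ c∈)
  3≤length a≢b a≢c b≢c (there a∈)  (here refl) (there c∈)  = s≤s (2≤length a≢c a∈ c∈)
  3≤length a≢b a≢c b≢c (there a∈)  (there b∈)  (here refl) = s≤s (2≤length a≢b a∈ b∈)
  3≤length a≢b a≢c b≢c (there a∈)  (there b∈)  (there c∈)  =
    m≤n⇒m≤1+n (3≤length a≢b a≢c b≢c a∈ b∈ c∈)

  sum-map-mono-≤ : (f g : A → ℕ) → (∀ a → f a ≤ g a) → ∀ xs → sum (map f xs) ≤ sum (map g xs)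
  sum-map-mono-≤ f g f≤g []       = z≤n
  sum-map-mono-≤ f g f≤g (x ∷ xs) = +-mono-≤ (f≤g x) (sum-map-mono-≤ f g f≤g xs)

  sum-map-mono-< : (f g : A → ℕ) → (∀ a → f a ≤ g a)
                 → ∀ {a xs} → a ∈ xs → f a < g a → sum (map f xs) < sum (map g xs)
  sum-map-mono-< f g f≤g {xs = x ∷ xs} (here refl) fa<ga = +-mono-<-≤ fa<ga (sum-map-mono-≤ f g f≤g xs)
  sum-map-mono-< f g f≤g {xs = x ∷ xs} (there a∈) fa<ga = +-mono-≤-< (f≤g x) (sum-map-mono-< f g f≤g a∈ fa<ga)

module _ {N : ℕ} (G : Graph N) where

  3≤numWeights : ∀ π {u v w} → weight G π u ≢ weight G π v → weight G π u ≢ weight G π w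
               → weight G π v ≢ weight G π w → 3 ≤ numWeights G π
  3≤numWeights π u≢v u≢w v≢w = 3≤length u≢v u≢w v≢w (weight∈ _) (weight∈ _) (weight∈ _)
    where
    weight∈ : ∀ u → weight G π u ∈ deduplicate _≟_ (map (weight G π) (allFin N))
    weight∈ u = ∈-deduplicate⁺ _≟_ (∈-map⁺ (weight G π) (∈-allFin u))

  neighbourLabel : Labeling N → Fin N → Fin N → ℕ
  neighbourLabel π u x = if adj G u x then label π x else 0

  weight-< : ∀ π {u u'} → ProperNbhdSubset G u u' → weight G π u < weight G π u'
  weight-< π {u} {u'} (N[u]⊆N[u'] , z , u'z , ¬uz) =
    sum-map-mono-< (neighbourLabel π u) (neighbourLabel π u') pointwise (∈-allFin z) at-z
    where
    pointwise : ∀ x → neighbourLabel π u x ≤ neighbourLabel π u' x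
    pointwise x with adj G u x in ux
    ... | false = z≤n
    ... | true rewrite N[u]⊆N[u'] x ux = ≤-refl

    at-z : neighbourLabel π u z < neighbourLabel π u' z
    at-z rewrite u'z with adj G u z
    ... | true  = ⊥-elim (¬uz refl)  -- the with-abstraction turned ¬uz into ¬ true ≡ true
    ... | false = s≤s z≤n

module _ {N : ℕ} (G : Graph N) (n : ℕ) where

  private
    L = lex G (edgeless n)

    layer : Fin (N * n) → Fin N
    layer u = proj₁ (remQuot {N} n u)

  adj-lex-edgeless : ∀ u w → adj L u w ≡ adj G (layer u) (layer w)
  adj-lex-edgeless u w with adj G (layer u) (layer w)
  ... | true  = refl
  ... | false = ∧-zeroʳ _

  adj-lex-edgeless-combine : ∀ g h w → adj L (combine g h) w ≡ adj G g (layer w)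
  adj-lex-edgeless-combine g h w =
    trans (adj-lex-edgeless (combine g h) w) (cong (λ p → adj G (proj₁ p) (layer w)) (remQuot-combine g h))

  adj-lex-edgeless-combine² : ∀ g h g' h' → adj L (combine g h) (combine g' h') ≡ adj G g g'
  adj-lex-edgeless-combine² g h g' h' =
    trans (adj-lex-edgeless-combine g h (combine g' h')) (cong (λ p → adj G g (proj₁ p)) (remQuot-combine g' h'))

  properNbhdSubset-lex-edgeless : ∀ {x y} h → ProperNbhdSubset G x y
                                → ProperNbhdSubset L (combine x h) (combine y h)
  properNbhdSubset-lex-edgeless {x} {y} h (N[x]⊆N[y] , z , yz , ¬xz) =
    N[xh]⊆N[yh] , combine z h , trans (adj-lex-edgeless-combine² y h z h) yz , ¬xh~zh
    where
    N[xh]⊆N[yh] : ∀ w → Adj L (combine x h) w → Adj L (combine y h) w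
    N[xh]⊆N[yh] w xw = trans (adj-lex-edgeless-combine y h w)
                             (N[x]⊆N[y] (layer w) (trans (sym (adj-lex-edgeless-combine x h w)) xw))

    ¬xh~zh : ¬ Adj L (combine x h) (combine z h)
    ¬xh~zh xz = ¬xz (trans (sym (adj-lex-edgeless-combine² x h z h)) xz)

mainTheorem10 : (n N : ℕ) → 1 ≤ n → (G : Graph N)
    → NoIsolated G
    → (∃ λ (π : Labeling (N * n)) → IsLDAL (lex G (edgeless n)) π)
    → (x y : Fin N)
    → (∃ λ (c : Fin N → Bool) → Bipartition G c × c x ≡ c y)
    → ProperNbhdSubset G x y
    → χld≥ (lex G (edgeless n)) 3
mainTheorem10 (suc n') N _ G noIsolated _ x y _ N[x]⊂N[y] π ldal =
  3≤numWeights L π (<⇒≢ (weight-< L π (properNbhdSubset-lex-edgeless G n zero N[x]⊂N[y])))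
    (ldal _ _ (trans (adj-lex-edgeless-combine² G n x zero v zero) xv))
    (ldal _ _ (trans (adj-lex-edgeless-combine² G n y zero v zero) (proj₁ N[x]⊂N[y] v xv)))
  where
  n = suc n'
  L = lex G (edgeless n)
  v = proj₁ (noIsolated x)
  xv = proj₂ (noIsolated x)
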